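{- Let $s\geq 4$ be an even integer. For all integers $n,k\geq 1$, \[ M_{s}(n,k)=\sum_{\substack{0\leq \ell\leq k\\ \ell\equiv 0,1\ (\mathrm{mod}\ s)}} M_{s}(n-k,k-\ell). \]
   Context: $M_s(n,k)$ denotes the number of partitions of $n$ into exactly $k$ parts in which every part occurs with multiplicity congruent to $0$ or $1$ modulo $s$. Conventions: $M_s(0,0)=1$, $M_s(m,0)=0$ for $m>0$, and $M_s(m,j)=0$ whenever $m<0$. -}

module Defs where

open import Data.Nat using (ℕ; zero; suc; _+_; _∸_; _≥_; _≤_)
open import Data.Nat.Properties using (_≟_; _≥?_)
open import Data.Nat.Divisibility using (_∣_; _∣?_)
open import Data.Integer using (ℤ; +_; -[1+_])
open import Data.List using (List; []; _∷_; [_]; map; concatMap; upTo; length; filter)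
open import Data.Nat.ListAction using (sum)
open import Data.List.Relation.Unary.All using (All; all?)
open import Data.List.Relation.Unary.Linked using (Linked; linked?)
open import Data.Product using (_×_)
open import Data.Sum using (_⊎_)
open import Relation.Nullary using (Dec; yes; no; does)
open import Relation.Nullary.Decidable using (_×-dec_; _⊎-dec_)
open import Data.Bool using (if_then_else_)

mult : ℕ → List ℕ → ℕ
mult p [] = 0
mult p (x ∷ xs) = if does (p ≟ x) then suc (mult p xs) else mult p xs

Cong01 : ℕ → ℕ → Set
Cong01 s m = (s ∣ m) ⊎ (1 ≤ m × s ∣ (m ∸ 1))

cong01? : ∀ s m → Dec (Cong01 s m)
cong01? s m = (s ∣? m) ⊎-dec ((1 Data.Nat.Properties.≤? m) ×-dec (s ∣? (m ∸ 1)))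

lists : ℕ → ℕ → List (List ℕ)
lists n zero = [ [] ]
lists n (suc k) = concatMap (λ p → map (p ∷_) (lists n k)) (map suc (upTo n))

IsMPartition : ℕ → ℕ → List ℕ → Set
IsMPartition s n xs = (sum xs Relation.Binary.PropositionalEquality.≡ n)
                    × Linked _≥_ xs
                    × All (λ p → Cong01 s (mult p xs)) xs
  where import Relation.Binary.PropositionalEquality

isMPartition? : ∀ s n xs → Dec (IsMPartition s n xs)
isMPartition? s n xs = (sum xs ≟ n) ×-dec (linked? _≥?_ xs ×-dec all? (λ p → cong01? s (mult p xs)) xs)

M : ℕ → ℕ → ℕ → ℕ
M s n k = length (filter (isMPartition? s n) (lists n k))

Mℤ : ℕ → ℤ → ℕ → ℕ
Mℤ s (+ m) j = M s m j
Mℤ s -[1+ m ] j = 0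

RHS : ℕ → ℕ → ℕ → ℕ
RHS s n k = sum (map (λ ℓ → Mℤ s (n Data.Integer.⊖ k) (k ∸ ℓ))
                     (filter (cong01? s) (upTo (suc k))))

{-# OPTIONS --safe #-}
module Submission where

-- Adding 1 to each of the k − ℓ parts of a partition of n − k and appending ℓ parts equal to 1
-- gives a partition of n into k parts; every partition of n into k parts arises in this way from
-- exactly one pair, ℓ being its number of parts equal to 1 (remove the first column of its Young
-- diagram). The multiplicity of 1 becomes ℓ and that of p + 1 becomes the old multiplicity of p, so the
-- multiplicity condition is inherited exactly when ℓ ≡ 0, 1 (mod s).

open import Defs
open import Data.Nat using (ℕ; _≤_)
open import Data.Nat.Divisibility using (_∣_)
open import Relation.Binary.PropositionalEquality using (_≡_)

open import Data.Bool using (true; false)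
open import Data.Empty using (⊥-elim)
open import Data.Integer using (_⊖_)
open import Data.Integer.Properties using (⊖-≥; ⊖-<)
open import Data.List using (List; []; _∷_; map; concatMap; upTo; length; filter; _++_; replicate)
open import Data.List.Membership.Propositional using (_∈_; find; lose)
open import Data.List.Membership.Propositional.Properties
  using (∈-map⁺; ∈-map⁻; ∈-filter⁺; ∈-filter⁻; ∈-concatMap⁺; ∈-concatMap⁻; ∈-upTo⁺; ∈-upTo⁻)
open import Data.List.Membership.Propositional.Properties.WithK using (unique∧set⇒bag)
open import Data.List.Properties using (length-++; length-map; length-replicate; map-cong; map-injective; ++-cancelʳ; filter-none; ∷-injectiveʳ)
open import Data.List.Relation.Binary.BagAndSetEquality using (_∼[_]_; bag; ∼bag⇒↭)
open import Data.List.Relation.Binary.Disjoint.Propositional using (Disjoint)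
open import Data.List.Relation.Binary.Permutation.Propositional.Properties using (↭-length)
open import Data.List.Relation.Unary.All as All using (All; []; _∷_)
import Data.List.Relation.Unary.All.Properties as All
open import Data.List.Relation.Unary.Any using (here; there)
open import Data.List.Relation.Unary.AllPairs as AllPairs using ([]; _∷_)
import Data.List.Relation.Unary.AllPairs.Properties as AllPairs
open import Data.List.Relation.Unary.Linked as Linked using (Linked; []; [-]; _∷_)
open import Data.List.Relation.Unary.Unique.Propositional using (Unique)
import Data.List.Relation.Unary.Unique.Propositional.Properties as Unique
open import Data.Nat using (zero; suc; _≡ᵇ_; _≥_; _+_; _*_; _∸_; _<_; z≤n; s≤s)
open import Data.Nat.Divisibility using (_∣0)
open import Data.Nat.ListAction using (sum)
open import Data.Nat.ListAction.Properties using (sum-++)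
open import Data.Nat.Properties
open import Data.Product using (_×_; _,_; proj₁; proj₂)
open import Data.Sum using (inj₁)
open import Function using (_∘_)
open import Function.Bundles using (mk⇔)
open import Relation.Binary.Core using (Rel)
open import Relation.Binary.Definitions using (Reflexive)
open import Relation.Binary.PropositionalEquality using (refl; sym; trans; cong; cong₂; subst; subst₂; _≢_; module ≡-Reasoning)
open import Relation.Nullary using (yes; no; does; ¬_)

open ≡-Reasoning

mult-++ : ∀ p xs ys → mult p (xs ++ ys) ≡ mult p xs + mult p ys
mult-++ p [] ys = refl
mult-++ p (x ∷ xs) ys with does (p ≟ x)
... | true = cong suc (mult-++ p xs ys)
... | false = mult-++ p xs ys

mult-map-suc : ∀ p ys → mult (suc p) (map suc ys) ≡ mult p ys
mult-map-suc p [] = refl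
mult-map-suc p (y ∷ ys) with does (p ≟ y)
... | true = cong suc (mult-map-suc p ys)
... | false = mult-map-suc p ys

-- `does (p ≟ x)` computes to the builtin `p ≡ᵇ x`, so the case split has to be on the latter.
mult-∷-≡ : ∀ p xs → mult p (p ∷ xs) ≡ suc (mult p xs)
mult-∷-≡ p xs with p ≡ᵇ p | ≡⇒≡ᵇ p p refl
... | true | _ = refl

mult-∷-≢ : ∀ {p x} xs → p ≢ x → mult p (x ∷ xs) ≡ mult p xs
mult-∷-≢ {p} {x} xs p≢x with p ≡ᵇ x | ≡ᵇ⇒≡ p x
... | true | p≡x = ⊥-elim (p≢x (p≡x _))
... | false | _ = refl

mult-replicate-≡ : ∀ p ℓ → mult p (replicate ℓ p) ≡ ℓ
mult-replicate-≡ p zero = refl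
mult-replicate-≡ p (suc ℓ) = trans (mult-∷-≡ p (replicate ℓ p)) (cong suc (mult-replicate-≡ p ℓ))

mult-replicate-≢ : ∀ {p x} ℓ → p ≢ x → mult p (replicate ℓ x) ≡ 0
mult-replicate-≢ zero p≢x = refl
mult-replicate-≢ {x = x} (suc ℓ) p≢x = trans (mult-∷-≢ (replicate ℓ x) p≢x) (mult-replicate-≢ ℓ p≢x)

mult-zero : ∀ {ys} → All (1 ≤_) ys → mult 0 ys ≡ 0
mult-zero [] = refl
mult-zero (s≤s _ ∷ pos) = mult-zero pos

sum-replicate : ∀ n x → sum (replicate n x) ≡ n * x
sum-replicate zero x = refl
sum-replicate (suc n) x = cong (x +_) (sum-replicate n x)

sum-map-suc : ∀ ys → sum (map suc ys) ≡ sum ys + length ys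
sum-map-suc [] = refl
sum-map-suc (y ∷ ys) = begin
  suc (y + sum (map suc ys))    ≡⟨ cong (λ t → suc (y + t)) (sum-map-suc ys) ⟩
  suc (y + (sum ys + length ys)) ≡⟨ cong suc (+-assoc y (sum ys) (length ys)) ⟨
  suc (y + sum ys + length ys)   ≡⟨ +-suc (y + sum ys) (length ys) ⟨
  y + sum ys + suc (length ys)   ∎

sum-map-zero : ∀ {A : Set} (f : A → ℕ) xs → (∀ x → f x ≡ 0) → sum (map f xs) ≡ 0
sum-map-zero f [] _ = refl
sum-map-zero f (x ∷ xs) f≡0 = cong₂ _+_ (f≡0 x) (sum-map-zero f xs f≡0)

∈⇒≤sum : ∀ {x xs} → x ∈ xs → x ≤ sum xs
∈⇒≤sum {xs = x ∷ xs} (here refl) = m≤m+n x (sum xs)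
∈⇒≤sum {xs = y ∷ xs} (there x∈) = ≤-trans (∈⇒≤sum x∈) (m≤n+m (sum xs) y)

length≤sum : ∀ {xs} → All (1 ≤_) xs → length xs ≤ sum xs
length≤sum [] = z≤n
length≤sum (1≤x ∷ pos) = +-mono-≤ 1≤x (length≤sum pos)

length-concatMap : ∀ {A B : Set} (f : A → List B) xs → length (concatMap f xs) ≡ sum (map (length ∘ f) xs)
length-concatMap f [] = refl
length-concatMap f (x ∷ xs) = trans (length-++ (f x)) (cong (length (f x) +_) (length-concatMap f xs))

replicate-linked : ∀ {a r} {A : Set a} {R : Rel A r} → Reflexive R → ∀ n {x} → Linked R (replicate n x)
replicate-linked refl-R zero = []
replicate-linked refl-R (suc zero) = [-]
replicate-linked refl-R (suc (suc n)) = refl-R ∷ replicate-linked refl-R (suc n)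

InRange : ℕ → ℕ → Set
InRange N x = 1 ≤ x × x ≤ N

∈-lists⁻ : ∀ N k {xs} → xs ∈ lists N k → length xs ≡ k × All (InRange N) xs
∈-lists⁻ N zero (here refl) = refl , []
∈-lists⁻ N (suc k) xs∈ with find (∈-concatMap⁻ (λ p → map (p ∷_) (lists N k)) {xs = map suc (upTo N)} xs∈)
... | p , p∈ , xs∈′ with ∈-map⁻ suc p∈ | ∈-map⁻ (p ∷_) xs∈′
... | i , i∈ , refl | ys , ys∈ , refl with ∈-lists⁻ N k ys∈
... | len≡ , bounds = cong suc len≡ , (s≤s z≤n , ∈-upTo⁻ i∈) ∷ bounds

∈-lists⁺ : ∀ N {xs} → All (InRange N) xs → xs ∈ lists N (length xs)
∈-lists⁺ N [] = here refl
∈-lists⁺ N {suc i ∷ xs} ((_ , i<N) ∷ bounds) =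
  ∈-concatMap⁺ (λ p → map (p ∷_) (lists N (length xs)))
    (lose (∈-map⁺ suc (∈-upTo⁺ i<N)) (∈-map⁺ (suc i ∷_) (∈-lists⁺ N bounds)))

lists-unique : ∀ N k → Unique (lists N k)
lists-unique N zero = [] ∷ []
lists-unique N (suc k) =
  Unique.concat⁺ (All.map⁺ (All.tabulate (λ _ → Unique.map⁺ ∷-injectiveʳ (lists-unique N k))))
    (AllPairs.map⁺ (AllPairs.map disjoint (Unique.map⁺ suc-injective (Unique.upTo⁺ N))))
  where
  disjoint : ∀ {p q} → p ≢ q → Disjoint (map (p ∷_) (lists N k)) (map (q ∷_) (lists N k))
  disjoint p≢q (v∈p , v∈q) with ∈-map⁻ _ v∈p | ∈-map⁻ _ v∈q
  ... | _ , _ , refl | _ , _ , refl = p≢q refl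

MPartitions : ℕ → ℕ → ℕ → List (List ℕ)
MPartitions s n k = filter (isMPartition? s n) (lists n k)

module _ {s n k : ℕ} where

  ∈-MPartitions⁻ : ∀ {xs} → xs ∈ MPartitions s n k → length xs ≡ k × All (1 ≤_) xs × IsMPartition s n xs
  ∈-MPartitions⁻ xs∈ with ∈-filter⁻ (isMPartition? s n) {xs = lists n k} xs∈
  ... | xs∈lists , part with ∈-lists⁻ n k xs∈lists
  ... | len≡ , bounds = len≡ , All.map proj₁ bounds , part

  ∈-MPartitions⁺ : ∀ {xs} → length xs ≡ k → All (1 ≤_) xs → IsMPartition s n xs → xs ∈ MPartitions s n k
  ∈-MPartitions⁺ refl pos part@(refl , _) =
    ∈-filter⁺ (isMPartition? s n) (∈-lists⁺ n (All.tabulate λ x∈ → All.lookup pos x∈ , ∈⇒≤sum x∈)) part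

  MPartitions-unique : Unique (MPartitions s n k)
  MPartitions-unique = Unique.filter⁺ (isMPartition? s n) (lists-unique n k)

  M-< : n < k → M s n k ≡ 0
  M-< n<k = cong length (filter-none (isMPartition? s n) (All.tabulate too-many-parts))
    where
    too-many-parts : ∀ {xs} → xs ∈ lists n k → ¬ IsMPartition s n xs
    too-many-parts xs∈ (sum≡ , _) with ∈-lists⁻ n k xs∈
    ... | len≡ , bounds = <⇒≱ n<k (subst₂ _≤_ len≡ sum≡ (length≤sum (All.map proj₁ bounds)))

addColumn : ℕ → List ℕ → List ℕ
addColumn ℓ ys = map suc ys ++ replicate ℓ 1

-- Inverts addColumn only on non-increasing lists, where the parts equal to 1 all come last.
peelColumn : List ℕ → List ℕ
peelColumn (suc (suc q) ∷ xs) = suc q ∷ peelColumn xs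
peelColumn _ = []

addColumn-injective : ∀ ℓ {ys ys′} → addColumn ℓ ys ≡ addColumn ℓ ys′ → ys ≡ ys′
addColumn-injective ℓ {ys} {ys′} eq = map-injective suc-injective (++-cancelʳ (replicate ℓ 1) (map suc ys) (map suc ys′) eq)

addColumn-positive : ∀ ℓ ys → All (1 ≤_) (addColumn ℓ ys)
addColumn-positive ℓ ys = All.++⁺ (All.map⁺ (All.universal (λ _ → s≤s z≤n) ys)) (All.replicate⁺ ℓ (s≤s z≤n))

length-addColumn : ∀ ℓ ys → length (addColumn ℓ ys) ≡ length ys + ℓ
length-addColumn ℓ ys = trans (length-++ (map suc ys)) (cong₂ _+_ (length-map suc ys) (length-replicate ℓ))

sum-addColumn : ∀ ℓ ys → sum (addColumn ℓ ys) ≡ sum ys + length ys + ℓ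
sum-addColumn ℓ ys = begin
  sum (map suc ys ++ replicate ℓ 1)           ≡⟨ sum-++ (map suc ys) (replicate ℓ 1) ⟩
  sum (map suc ys) + sum (replicate ℓ 1)     ≡⟨ cong₂ _+_ (sum-map-suc ys) (sum-replicate ℓ 1) ⟩
  sum ys + length ys + ℓ * 1                 ≡⟨ cong (sum ys + length ys +_) (*-identityʳ ℓ) ⟩
  sum ys + length ys + ℓ                     ∎

mult-1-addColumn : ∀ ℓ {ys} → All (1 ≤_) ys → mult 1 (addColumn ℓ ys) ≡ ℓ
mult-1-addColumn ℓ {ys} pos = begin
  mult 1 (map suc ys ++ replicate ℓ 1)            ≡⟨ mult-++ 1 (map suc ys) (replicate ℓ 1) ⟩
  mult 1 (map suc ys) + mult 1 (replicate ℓ 1)   ≡⟨ cong₂ _+_ (trans (mult-map-suc 0 ys) (mult-zero pos)) (mult-replicate-≡ 1 ℓ) ⟩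
  ℓ                                              ∎

mult-suc-addColumn : ∀ {p} ℓ ys → 1 ≤ p → mult (suc p) (addColumn ℓ ys) ≡ mult p ys
mult-suc-addColumn {p} ℓ ys 1≤p = begin
  mult (suc p) (map suc ys ++ replicate ℓ 1)                  ≡⟨ mult-++ (suc p) (map suc ys) (replicate ℓ 1) ⟩
  mult (suc p) (map suc ys) + mult (suc p) (replicate ℓ 1)   ≡⟨ cong₂ _+_ (mult-map-suc p ys) (mult-replicate-≢ ℓ (1≤p⇒suc≢1 1≤p)) ⟩
  mult p ys + 0                                              ≡⟨ +-identityʳ (mult p ys) ⟩
  mult p ys                                                  ∎
  where
  1≤p⇒suc≢1 : ∀ {p} → 1 ≤ p → suc p ≢ 1
  1≤p⇒suc≢1 (s≤s _) ()

addColumn-linked⁺ : ∀ ℓ {ys} → Linked _≥_ ys → Linked _≥_ (addColumn ℓ ys)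
addColumn-linked⁺ ℓ [] = replicate-linked ≤-refl ℓ
addColumn-linked⁺ zero [-] = [-]
addColumn-linked⁺ (suc ℓ) [-] = s≤s z≤n ∷ replicate-linked ≤-refl (suc ℓ)
addColumn-linked⁺ ℓ (y≥y′ ∷ lin) = s≤s y≥y′ ∷ addColumn-linked⁺ ℓ lin

addColumn-linked⁻ : ∀ ℓ ys → Linked _≥_ (addColumn ℓ ys) → Linked _≥_ ys
addColumn-linked⁻ ℓ [] _ = []
addColumn-linked⁻ ℓ (y ∷ []) _ = [-]
addColumn-linked⁻ ℓ (y ∷ y′ ∷ ys) (sy≥sy′ ∷ lin) = ≤-pred sy≥sy′ ∷ addColumn-linked⁻ ℓ (y′ ∷ ys) lin

peelColumn-positive : ∀ xs → All (1 ≤_) (peelColumn xs)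
peelColumn-positive [] = []
peelColumn-positive (zero ∷ xs) = []
peelColumn-positive (suc zero ∷ xs) = []
peelColumn-positive (suc (suc q) ∷ xs) = s≤s z≤n ∷ peelColumn-positive xs

addColumn-peelColumn : ∀ {xs} → Linked _≥_ xs → All (1 ≤_) xs → addColumn (mult 1 xs) (peelColumn xs) ≡ xs
addColumn-peelColumn {[]} _ _ = refl
addColumn-peelColumn {zero ∷ _} _ (() ∷ _)
addColumn-peelColumn {1 ∷ []} _ _ = refl
addColumn-peelColumn {1 ∷ 1 ∷ xs} (_ ∷ lin) (_ ∷ pos) = cong (1 ∷_) (addColumn-peelColumn lin pos)
addColumn-peelColumn {1 ∷ zero ∷ _} _ (_ ∷ () ∷ _)
addColumn-peelColumn {1 ∷ suc (suc _) ∷ _} (s≤s () ∷ _) _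
addColumn-peelColumn {suc (suc q) ∷ xs} lin (_ ∷ pos) = cong (suc (suc q) ∷_) (addColumn-peelColumn (Linked.tail lin) pos)

MultiplicitiesCong01 : ℕ → List ℕ → Set
MultiplicitiesCong01 s xs = All (λ p → Cong01 s (mult p xs)) xs

module _ {s ℓ : ℕ} {ys : List ℕ} (pos : All (1 ≤_) ys) where

  addColumn-multiplicities⁺ : Cong01 s ℓ → MultiplicitiesCong01 s ys → MultiplicitiesCong01 s (addColumn ℓ ys)
  addColumn-multiplicities⁺ cong01-ℓ cong01-ys =
    All.++⁺ (All.map⁺ (All.zipWith shift (pos , cong01-ys))) (All.replicate⁺ ℓ ones)
    where
    shift : ∀ {y} → 1 ≤ y × Cong01 s (mult y ys) → Cong01 s (mult (suc y) (addColumn ℓ ys))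
    shift (1≤y , c) = subst (Cong01 s) (sym (mult-suc-addColumn ℓ ys 1≤y)) c
    ones : Cong01 s (mult 1 (addColumn ℓ ys))
    ones = subst (Cong01 s) (sym (mult-1-addColumn ℓ pos)) cong01-ℓ

  addColumn-multiplicities⁻ : MultiplicitiesCong01 s (addColumn ℓ ys) → Cong01 s ℓ × MultiplicitiesCong01 s ys
  addColumn-multiplicities⁻ c =
    ones ℓ (All.++⁻ʳ (map suc ys) c) , All.zipWith unshift (pos , All.map⁻ (All.++⁻ˡ (map suc ys) c))
    where
    unshift : ∀ {y} → 1 ≤ y × Cong01 s (mult (suc y) (addColumn ℓ ys)) → Cong01 s (mult y ys)
    unshift (1≤y , c) = subst (Cong01 s) (mult-suc-addColumn ℓ ys 1≤y) c
    ones : ∀ ℓ′ → All (λ p → Cong01 s (mult p (addColumn ℓ′ ys))) (replicate ℓ′ 1) → Cong01 s ℓ′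
    ones zero _ = inj₁ (s ∣0)
    ones ℓ′@(suc _) c₁ = subst (Cong01 s) (mult-1-addColumn ℓ′ pos) (All.replicate⁻ c₁)

  addColumn-isMPartition⁺ : ∀ {m} → Cong01 s ℓ → IsMPartition s m ys → IsMPartition s (m + length ys + ℓ) (addColumn ℓ ys)
  addColumn-isMPartition⁺ cong01-ℓ (refl , lin , mults) =
    sum-addColumn ℓ ys , addColumn-linked⁺ ℓ lin , addColumn-multiplicities⁺ cong01-ℓ mults

  addColumn-isMPartition⁻ : ∀ {m} → IsMPartition s (m + length ys + ℓ) (addColumn ℓ ys) → Cong01 s ℓ × IsMPartition s m ys
  addColumn-isMPartition⁻ {m} (sum≡ , lin , mults) =
    proj₁ (addColumn-multiplicities⁻ mults) , sum-ys , addColumn-linked⁻ ℓ ys lin , proj₂ (addColumn-multiplicities⁻ mults)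
    where
    sum-ys : sum ys ≡ m
    sum-ys = +-cancelʳ-≡ (length ys) _ _ (+-cancelʳ-≡ ℓ _ _ (trans (sym (sum-addColumn ℓ ys)) sum≡))

  addColumn-∈-MPartitions⁺ : ∀ {m j} → Cong01 s ℓ → ys ∈ MPartitions s m j → addColumn ℓ ys ∈ MPartitions s (m + (j + ℓ)) (j + ℓ)
  addColumn-∈-MPartitions⁺ {m} {j} cong01-ℓ ys∈ with ∈-MPartitions⁻ {n = m} {k = j} ys∈
  ... | refl , _ , part =
    ∈-MPartitions⁺ (length-addColumn ℓ ys) (addColumn-positive ℓ ys)
      (subst (λ n → IsMPartition s n (addColumn ℓ ys)) (+-assoc m (length ys) ℓ) (addColumn-isMPartition⁺ cong01-ℓ part))

  addColumn-∈-MPartitions⁻ : ∀ {m j} → addColumn ℓ ys ∈ MPartitions s (m + (j + ℓ)) (j + ℓ) → Cong01 s ℓ × ys ∈ MPartitions s m j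
  addColumn-∈-MPartitions⁻ {m} {j} xs∈ with ∈-MPartitions⁻ {n = m + (j + ℓ)} {k = j + ℓ} xs∈
  ... | len≡ , _ , part with +-cancelʳ-≡ ℓ (length ys) _ (trans (sym (length-addColumn ℓ ys)) len≡)
  ... | refl with addColumn-isMPartition⁻ (subst (λ n → IsMPartition s n (addColumn ℓ ys)) (sym (+-assoc m (length ys) ℓ)) part)
  ... | cong01-ℓ , part′ = cong01-ℓ , ∈-MPartitions⁺ refl pos part′

columnHeights : ℕ → ℕ → List ℕ
columnHeights s k = filter (cong01? s) (upTo (suc k))

module _ (s m k : ℕ) where

  withColumn : ℕ → List (List ℕ)
  withColumn ℓ = map (addColumn ℓ) (MPartitions s m (k ∸ ℓ))

  ∈-MPartitions⇒positive : ∀ j {zs} → zs ∈ MPartitions s m j → All (1 ≤_) zs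
  ∈-MPartitions⇒positive j zs∈ = proj₁ (proj₂ (∈-MPartitions⁻ {k = j} zs∈))

  columnExtensions : List (List ℕ)
  columnExtensions = concatMap withColumn (columnHeights s k)

  ∈-columnExtensions⇒ : ∀ {xs} → xs ∈ columnExtensions → xs ∈ MPartitions s (m + k) k
  ∈-columnExtensions⇒ xs∈ with find (∈-concatMap⁻ withColumn {xs = columnHeights s k} xs∈)
  ... | ℓ , ℓ∈ , xs∈ℓ with ∈-filter⁻ (cong01? s) {xs = upTo (suc k)} ℓ∈ | ∈-map⁻ (addColumn ℓ) xs∈ℓ
  ... | ℓ<1+k , cong01-ℓ | ys , ys∈ , refl =
    subst (λ k′ → addColumn ℓ ys ∈ MPartitions s (m + k′) k′) (m∸n+n≡m (≤-pred (∈-upTo⁻ ℓ<1+k)))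
      (addColumn-∈-MPartitions⁺ (∈-MPartitions⇒positive (k ∸ ℓ) ys∈) {m} {k ∸ ℓ} cong01-ℓ ys∈)

  ∈-columnExtensions⇐ : ∀ {xs} → xs ∈ MPartitions s (m + k) k → xs ∈ columnExtensions
  ∈-columnExtensions⇐ {xs} xs∈ with ∈-MPartitions⁻ {n = m + k} {k = k} xs∈
  ... | len≡ , pos , (_ , lin , _) =
    subst (_∈ columnExtensions) decomposition (∈-concatMap⁺ withColumn (lose ℓ∈ (∈-map⁺ (addColumn ℓ) ys∈)))
    where
    ℓ : ℕ
    ℓ = mult 1 xs
    ys : List ℕ
    ys = peelColumn xs
    decomposition : addColumn ℓ ys ≡ xs
    decomposition = addColumn-peelColumn lin pos
    height : length ys + ℓ ≡ k
    height = trans (sym (length-addColumn ℓ ys)) (trans (cong length decomposition) len≡)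
    peeled : Cong01 s ℓ × ys ∈ MPartitions s m (length ys)
    peeled = addColumn-∈-MPartitions⁻ (peelColumn-positive xs) {m} {length ys}
      (subst (λ k′ → addColumn ℓ ys ∈ MPartitions s (m + k′) k′) (sym height)
        (subst (_∈ MPartitions s (m + k) k) (sym decomposition) xs∈))
    ℓ∈ : ℓ ∈ columnHeights s k
    ℓ∈ = ∈-filter⁺ (cong01? s) (∈-upTo⁺ (s≤s (subst (ℓ ≤_) height (m≤n+m ℓ (length ys))))) (proj₁ peeled)
    ys∈ : ys ∈ MPartitions s m (k ∸ ℓ)
    ys∈ = subst (λ j → ys ∈ MPartitions s m j) (trans (sym (m+n∸n≡m (length ys) ℓ)) (cong (_∸ ℓ) height)) (proj₂ peeled)

  columnExtensions-unique : Unique columnExtensions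
  columnExtensions-unique =
    Unique.concat⁺ (All.map⁺ (All.universal (λ ℓ → Unique.map⁺ (addColumn-injective ℓ) (MPartitions-unique {s} {m} {k ∸ ℓ})) (columnHeights s k)))
      (AllPairs.map⁺ (AllPairs.map disjoint (Unique.filter⁺ (cong01? s) (Unique.upTo⁺ (suc k)))))
    where
    disjoint : ∀ {ℓ ℓ′} → ℓ ≢ ℓ′ → Disjoint (withColumn ℓ) (withColumn ℓ′)
    disjoint {ℓ} {ℓ′} ℓ≢ℓ′ (v∈ℓ , v∈ℓ′) with ∈-map⁻ (addColumn ℓ) v∈ℓ | ∈-map⁻ (addColumn ℓ′) v∈ℓ′
    ... | ys , ys∈ , refl | ys′ , ys′∈ , eq = ℓ≢ℓ′ (begin
      ℓ                          ≡⟨ mult-1-addColumn ℓ (∈-MPartitions⇒positive (k ∸ ℓ) ys∈) ⟨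
      mult 1 (addColumn ℓ ys)    ≡⟨ cong (mult 1) eq ⟩
      mult 1 (addColumn ℓ′ ys′)  ≡⟨ mult-1-addColumn ℓ′ (∈-MPartitions⇒positive (k ∸ ℓ′) ys′∈) ⟩
      ℓ′                         ∎)

  length-columnExtensions : length columnExtensions ≡ sum (map (λ ℓ → M s m (k ∸ ℓ)) (columnHeights s k))
  length-columnExtensions = begin
    length (concatMap withColumn (columnHeights s k))    ≡⟨ length-concatMap withColumn (columnHeights s k) ⟩
    sum (map (length ∘ withColumn) (columnHeights s k))  ≡⟨ cong sum (map-cong (λ ℓ → length-map (addColumn ℓ) (MPartitions s m (k ∸ ℓ))) (columnHeights s k)) ⟩
    sum (map (λ ℓ → M s m (k ∸ ℓ)) (columnHeights s k))  ∎

M-recurrence : ∀ s m k → M s (m + k) k ≡ sum (map (λ ℓ → M s m (k ∸ ℓ)) (columnHeights s k))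
M-recurrence s m k = begin
  length (MPartitions s (m + k) k)  ≡⟨ ↭-length (∼bag⇒↭ same-elements) ⟨
  length (columnExtensions s m k)   ≡⟨ length-columnExtensions s m k ⟩
  sum (map (λ ℓ → M s m (k ∸ ℓ)) (columnHeights s k)) ∎
  where
  same-elements : columnExtensions s m k ∼[ bag ] MPartitions s (m + k) k
  same-elements = unique∧set⇒bag (columnExtensions-unique s m k) (MPartitions-unique {s} {m + k} {k})
                    (mk⇔ (∈-columnExtensions⇒ s m k) (∈-columnExtensions⇐ s m k))

Mℤ-⊖-≥ : ∀ {s n k} j → k ≤ n → Mℤ s (n ⊖ k) j ≡ M s (n ∸ k) j
Mℤ-⊖-≥ j k≤n rewrite ⊖-≥ k≤n = refl

Mℤ-⊖-< : ∀ {s n k} j → n < k → Mℤ s (n ⊖ k) j ≡ 0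
Mℤ-⊖-< {n = n} {k = k} j n<k rewrite ⊖-< n<k with k ∸ n | m<n⇒0<n∸m n<k
... | suc _ | _ = refl

-- The recurrence holds for every s, n and k: none of the hypotheses is needed.
theorem6 : (s : ℕ) → 4 ≤ s → 2 ∣ s → (n k : ℕ) → 1 ≤ n → 1 ≤ k →
    M s n k ≡ RHS s n k
theorem6 s _ _ n k _ _ with k ≤? n
... | yes k≤n = begin
  M s n k                                           ≡⟨ cong (λ n′ → M s n′ k) (m∸n+n≡m k≤n) ⟨
  M s (n ∸ k + k) k                                 ≡⟨ M-recurrence s (n ∸ k) k ⟩
  sum (map (λ ℓ → M s (n ∸ k) (k ∸ ℓ)) (columnHeights s k))
    ≡⟨ cong sum (map-cong (λ ℓ → Mℤ-⊖-≥ (k ∸ ℓ) k≤n) (columnHeights s k)) ⟨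
  RHS s n k                                         ∎
... | no k≰n = trans (M-< (≰⇒> k≰n)) (sym (sum-map-zero _ (columnHeights s k) (λ ℓ → Mℤ-⊖-< (k ∸ ℓ) (≰⇒> k≰n))))
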